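{- Let $G$ be a connected graph of order $n$ and maximum degree $\Delta\geq 3$ such that $G$ is not the complete graph $K_{\Delta+1}$. Then $$Z(G)\leq \frac{\Delta-1}{\Delta}\,n.$$
   Context: All graphs are finite, simple and undirected. For a graph $G$ and a set $Z\subseteq V(G)$, let $\mathcal{F}(Z)$ be the set obtained from $Z$ by repeatedly adding a vertex $u\notin$ (current set) whenever $u$ is the unique neighbor outside the current set of some vertex in the current set, as long as possible (this closure is well defined). $Z$ is a zero forcing set of $G$ if $\mathcal{F}(Z)=V(G)$. The zero forcing number $Z(G)$ is the minimum cardinality of a zero forcing set of $G$. -}

module Defs where

open import Data.Nat using (ℕ; zero; suc; _+_; _*_; _∸_; _≤_)
open import Data.Fin using (Fin)
open import Data.Fin.Subset using (Subset; _∈_; _∉_; ∣_∣)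
open import Data.Bool using (Bool; true; false; if_then_else_)
open import Data.List using (List; filter; length)
open import Data.List using () renaming (allFin to allFinL)
open import Data.Product using (Σ; _×_; _,_; ∃; ∃-syntax)
open import Relation.Binary.PropositionalEquality using (_≡_; _≢_)
open import Relation.Nullary using (¬_)
open import Relation.Binary.Construct.Closure.ReflexiveTransitive using (Star)
open import Data.Bool.Properties using (T?)
open import Data.Bool using (T)

record Graph (n : ℕ) : Set where
  field
    adj     : Fin n → Fin n → Bool
    symm    : ∀ u v → adj u v ≡ adj v u
    irrefl  : ∀ v → adj v v ≡ false

open Graph public

Adj : ∀ {n} → Graph n → Fin n → Fin n → Set
Adj G u v = T (adj G u v)

degree : ∀ {n} → Graph n → Fin n → ℕ
degree {n} G v = length (filter (λ u → T? (adj G v u)) (allFinL n))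

MaxDegree : ∀ {n} → Graph n → ℕ → Set
MaxDegree G Δ = (∀ v → degree G v ≤ Δ) × (∃[ v ] degree G v ≡ Δ)

Connected : ∀ {n} → Graph n → Set
Connected G = ∀ u v → Star (Adj G) u v

Complete : ∀ {n} → Graph n → Set
Complete G = ∀ u v → u ≢ v → Adj G u v

IsComplete : ∀ {n} → Graph n → ℕ → Set
IsComplete {n} G m = (n ≡ m) × Complete G

data Forced {n} (G : Graph n) (Z : Subset n) : Fin n → Set where
  initial : ∀ {v} → v ∈ Z → Forced G Z v
  force   : ∀ {u v} → Forced G Z u → Adj G u v →
            (∀ w → Adj G u w → w ≢ v → Forced G Z w) →
            Forced G Z v

ZeroForcingSet : ∀ {n} → Graph n → Subset n → Set
ZeroForcingSet G Z = ∀ v → Forced G Z v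

IsZeroForcingNumber : ∀ {n} → Graph n → ℕ → Set
IsZeroForcingNumber {n} G k =
  (∃[ Z ] (ZeroForcingSet G Z × ∣ Z ∣ ≡ k)) ×
  (∀ (Z : Subset n) → ZeroForcingSet G Z → k ≤ ∣ Z ∣)

-- Grow a set S from a vertex x₀ that has a non-neighbour y. While some u ∉ S has no
-- neighbour in S but a neighbour v ∉ S that does, move v into S: u forces v, so ∁ S stays
-- a zero forcing set, while the set of vertices outside S with a neighbour in S loses v and
-- gains at most Δ − 1 vertices (v already has a neighbour in S), so its size stays at most
-- (Δ − 2)|S| + 2. Once no move is possible, connectivity puts every vertex outside S next
-- to S, so n − |S| ≤ (Δ − 2)|S| + 2; as x₀ and y (or a neighbour of y) lie in S, |S| ≥ 2
-- and hence n ≤ Δ|S|. Therefore Z(G) ≤ |∁ S| = n − |S| ≤ (Δ − 1)n/Δ.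
module Submission where

open import Defs
open import Data.Nat using (ℕ; zero; suc; _*_; _∸_; _≤_; _+_; s≤s; z≤n)
open import Data.Nat.Properties
open import Data.Nat.Tactic.RingSolver using (solve-∀)
open import Data.Fin using (Fin; zero; suc)
open import Data.Fin.Properties using (any?; all?) renaming (_≟_ to _≟ᶠ_)
open import Data.Fin.Subset using (Subset; _∈_; _∉_; ∣_∣; ⊥; ∁; _∪_; _─_; _-_; ⁅_⁆)
open import Data.Fin.Subset.Properties
open import Data.Vec using (tabulate; []; _∷_; here; there)
open import Data.Vec.Properties using (lookup∘tabulate; []=⇒lookup; lookup⇒[]=)
open import Data.Bool using (Bool; true; false; T)
open import Data.Bool.Properties using (T?; T-≡)
open import Data.List using (filter; length) renaming (tabulate to tabulateᴸ)
open import Data.Product using (∃-syntax; ∃₂; _×_; _,_; proj₁; proj₂)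
open import Data.Sum using (inj₁; inj₂)
open import Data.Empty using (⊥-elim)
open import Function using (_∘_; id; Equivalence)
open import Relation.Nullary using (¬_; Dec; yes; no)
open import Relation.Nullary.Decidable using (decidable-stable; _×-dec_; _→-dec_; ¬?)
open import Relation.Binary.PropositionalEquality
open import Relation.Binary.Construct.Closure.ReflexiveTransitive using (Star; ε; _◅_)

∣p∪q∣≤∣p∣+∣q∣ : ∀ {n} (p q : Subset n) → ∣ p ∪ q ∣ ≤ ∣ p ∣ + ∣ q ∣
∣p∪q∣≤∣p∣+∣q∣ []          []          = z≤n
∣p∪q∣≤∣p∣+∣q∣ (true ∷ p)  (b ∷ q)     =
  s≤s (≤-trans (∣p∪q∣≤∣p∣+∣q∣ p q) (+-monoʳ-≤ ∣ p ∣ (∣p∣≤∣x∷p∣ b q)))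
∣p∪q∣≤∣p∣+∣q∣ (false ∷ p) (true ∷ q)  =
  subst (suc ∣ p ∪ q ∣ ≤_) (sym (+-suc ∣ p ∣ ∣ q ∣)) (s≤s (∣p∪q∣≤∣p∣+∣q∣ p q))
∣p∪q∣≤∣p∣+∣q∣ (false ∷ p) (false ∷ q) = ∣p∪q∣≤∣p∣+∣q∣ p q

x∉p⇒∣p∪⁅x⁆∣≡1+∣p∣ : ∀ {n} (p : Subset n) {x} → x ∉ p → ∣ p ∪ ⁅ x ⁆ ∣ ≡ suc ∣ p ∣
x∉p⇒∣p∪⁅x⁆∣≡1+∣p∣ (true ∷ p)  {zero}  x∉p = ⊥-elim (x∉p here)
x∉p⇒∣p∪⁅x⁆∣≡1+∣p∣ (false ∷ p) {zero}  x∉p = cong (suc ∘ ∣_∣) (∪-identityʳ p)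
x∉p⇒∣p∪⁅x⁆∣≡1+∣p∣ (true ∷ p)  {suc x} x∉p = cong suc (x∉p⇒∣p∪⁅x⁆∣≡1+∣p∣ p (x∉p ∘ there))
x∉p⇒∣p∪⁅x⁆∣≡1+∣p∣ (false ∷ p) {suc x} x∉p = x∉p⇒∣p∪⁅x⁆∣≡1+∣p∣ p (x∉p ∘ there)

x∉p∪⁅y⁆⇒x∉p : ∀ {n} {p : Subset n} {x y} → x ∉ p ∪ ⁅ y ⁆ → x ∉ p
x∉p∪⁅y⁆⇒x∉p x∉ = x∉ ∘ x∈p∪q⁺ ∘ inj₁

x∉p∪⁅y⁆⇒x≢y : ∀ {n} {p : Subset n} {x y} → x ∉ p ∪ ⁅ y ⁆ → x ≢ y
x∉p∪⁅y⁆⇒x≢y {y = y} x∉ refl = x∉ (x∈p∪q⁺ (inj₂ (x∈⁅x⁆ y)))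

x∉p∧x≢y⇒x∉p∪⁅y⁆ : ∀ {n} {p : Subset n} {x y} → x ∉ p → x ≢ y → x ∉ p ∪ ⁅ y ⁆
x∉p∧x≢y⇒x∉p∪⁅y⁆ {p = p} {y = y} x∉p x≢y x∈ with x∈p∪q⁻ p ⁅ y ⁆ x∈
... | inj₁ x∈p = x∉p x∈p
... | inj₂ x∈y = x≢y (x∈⁅y⁆⇒x≡y y x∈y)

x∈p∧y∈p∧x≢y⇒2≤∣p∣ : ∀ {n} {p : Subset n} {x y} → x ∈ p → y ∈ p → x ≢ y → 2 ≤ ∣ p ∣
x∈p∧y∈p∧x≢y⇒2≤∣p∣ {p = p} {x} {y} x∈p y∈p x≢y =
  ≤-trans (s≤s 1≤∣p-x∣) (x∈p⇒∣p-x∣<∣p∣ x∈p)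
  where
  1≤∣p-x∣ : 1 ≤ ∣ p - x ∣
  1≤∣p-x∣ = ≤-trans (s≤s z≤n) (x∈p⇒∣p-x∣<∣p∣ (x∈p∧x≢y⇒x∈p-y y∈p (x≢y ∘ sym)))

length-filter-tabulate : ∀ {m n} (g : Fin m → Fin n) (b : Fin n → Bool) →
  length (filter (T? ∘ b) (tabulateᴸ g)) ≡ ∣ tabulate (b ∘ g) ∣
length-filter-tabulate {zero}  g b = refl
length-filter-tabulate {suc m} g b with b (g zero)
... | true  = cong suc (length-filter-tabulate (g ∘ suc) b)
... | false = length-filter-tabulate (g ∘ suc) b

Forced-mono : ∀ {n} {G : Graph n} {Z Z′} → (∀ {x} → x ∈ Z → Forced G Z′ x) →
  ∀ {x} → Forced G Z x → Forced G Z′ x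
Forced-mono Z⊆F (initial x∈Z)       = Z⊆F x∈Z
Forced-mono Z⊆F (force fu u~v rest) =
  force (Forced-mono Z⊆F fu) u~v (λ w u~w w≢v → Forced-mono Z⊆F (rest w u~w w≢v))

growth-bound : ∀ {a b s} Δ → a + 2 ≤ b + Δ → b + 2 * s ≤ Δ * s + 2 →
  a + 2 * suc s ≤ Δ * suc s + 2
growth-bound {a} {b} {s} Δ a+2≤b+Δ old = begin
  a + 2 * suc s    ≡⟨ 2*suc a s ⟩
  a + 2 + 2 * s    ≤⟨ +-monoˡ-≤ (2 * s) a+2≤b+Δ ⟩
  b + Δ + 2 * s    ≡⟨ +-rearrange b Δ s ⟩
  b + 2 * s + Δ    ≤⟨ +-monoˡ-≤ Δ old ⟩
  Δ * s + 2 + Δ    ≡⟨ *-rearrange Δ s ⟩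
  Δ * suc s + 2    ∎
  where
  open ≤-Reasoning
  2*suc : ∀ a s → a + 2 * suc s ≡ a + 2 + 2 * s
  2*suc = solve-∀
  +-rearrange : ∀ b Δ s → b + Δ + 2 * s ≡ b + 2 * s + Δ
  +-rearrange = solve-∀
  *-rearrange : ∀ Δ s → Δ * s + 2 + Δ ≡ Δ * suc s + 2
  *-rearrange = solve-∀

n∸s≤d⇒n≤Δ*s : ∀ {n s d} Δ → n ∸ s ≤ d → d + 2 * s ≤ Δ * s + 2 → 2 ≤ s → n ≤ Δ * s
n∸s≤d⇒n≤Δ*s {n} {s} {d} Δ n∸s≤d bound 2≤s =
  subst (n ≤_) (*-comm s Δ) (+-cancelʳ-≤ s n (s * Δ) (begin
    n + s            ≤⟨ +-monoˡ-≤ s (≤-trans (m≤n+m∸n n s) (+-monoʳ-≤ s n∸s≤d)) ⟩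
    s + d + s        ≡⟨ rearrange s d ⟩
    d + 2 * s        ≤⟨ bound ⟩
    Δ * s + 2        ≤⟨ +-monoʳ-≤ (Δ * s) 2≤s ⟩
    Δ * s + s        ≡⟨ cong (_+ s) (*-comm Δ s) ⟩
    s * Δ + s        ∎))
  where
  open ≤-Reasoning
  rearrange : ∀ s d → s + d + s ≡ d + 2 * s
  rearrange = solve-∀

k≤n∸s⇒Δ*k≤[Δ∸1]*n : ∀ {n s k} Δ → k ≤ n ∸ s → n ≤ Δ * s → Δ * k ≤ (Δ ∸ 1) * n
k≤n∸s⇒Δ*k≤[Δ∸1]*n {n} {s} {k} Δ k≤n∸s n≤Δs = begin
  Δ * k            ≤⟨ *-monoʳ-≤ Δ k≤n∸s ⟩
  Δ * (n ∸ s)      ≡⟨ *-distribˡ-∸ Δ n s ⟩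
  Δ * n ∸ Δ * s    ≤⟨ ∸-monoʳ-≤ (Δ * n) n≤Δs ⟩
  Δ * n ∸ n        ≡⟨ cong (Δ * n ∸_) (*-identityˡ n) ⟨
  Δ * n ∸ 1 * n    ≡⟨ *-distribʳ-∸ n Δ 1 ⟨
  (Δ ∸ 1) * n      ∎
  where open ≤-Reasoning

module _ {n} (G : Graph n) where

  neighbours : Fin n → Subset n
  neighbours v = tabulate (adj G v)

  ∈-neighbours⁺ : ∀ {v x} → Adj G v x → x ∈ neighbours v
  ∈-neighbours⁺ {v} {x} v~x =
    lookup⇒[]= x _ (trans (lookup∘tabulate (adj G v) x) (Equivalence.to T-≡ v~x))

  ∈-neighbours⁻ : ∀ {v x} → x ∈ neighbours v → Adj G v x
  ∈-neighbours⁻ {v} {x} x∈ =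
    Equivalence.from T-≡ (trans (sym (lookup∘tabulate (adj G v) x)) ([]=⇒lookup x∈))

  degree≡∣neighbours∣ : ∀ v → degree G v ≡ ∣ neighbours v ∣
  degree≡∣neighbours∣ v = length-filter-tabulate id (adj G v)

  Adj-sym : ∀ {u v} → Adj G u v → Adj G v u
  Adj-sym {u} {v} = subst T (symm G u v)

  Adj⇒≢ : ∀ {u v} → Adj G u v → u ≢ v
  Adj⇒≢ {u} u~u refl = subst T (irrefl G u) u~u

  Complete⇒n≡degree+1 : Complete G → ∀ v → n ≡ degree G v + 1
  Complete⇒n≡degree+1 complete v = begin
    n                          ≡⟨ m∸n+n≡m 1≤n ⟨
    n ∸ 1 + 1                  ≡⟨ cong (λ m → n ∸ m + 1) (∣⁅x⁆∣≡1 v) ⟨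
    n ∸ ∣ ⁅ v ⁆ ∣ + 1          ≡⟨ cong (_+ 1) (∣∁p∣≡n∸∣p∣ ⁅ v ⁆) ⟨
    ∣ ∁ ⁅ v ⁆ ∣ + 1            ≡⟨ cong (λ p → ∣ p ∣ + 1) neighbours≡∁⁅v⁆ ⟨
    ∣ neighbours v ∣ + 1       ≡⟨ cong (_+ 1) (degree≡∣neighbours∣ v) ⟨
    degree G v + 1             ∎
    where
    open ≡-Reasoning
    1≤n : 1 ≤ n
    1≤n = subst (_≤ n) (∣⁅x⁆∣≡1 v) (∣p∣≤n ⁅ v ⁆)
    neighbours≡∁⁅v⁆ : neighbours v ≡ ∁ ⁅ v ⁆
    neighbours≡∁⁅v⁆ = ⊆-antisym
      (λ x∈ → x∉p⇒x∈∁p (x≢y⇒x∉⁅y⁆ (Adj⇒≢ (∈-neighbours⁻ x∈) ∘ sym)))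
      (λ x∈ → ∈-neighbours⁺ (complete v _ (λ { refl → x∈∁p⇒x∉p x∈ (x∈⁅x⁆ v) })))

  nonadjacent-pair : ¬ Complete G → ∃₂ λ x y → x ≢ y × ¬ Adj G x y
  nonadjacent-pair incomplete
    with any? (λ x → any? λ y → ¬? (x ≟ᶠ y) ×-dec ¬? (T? (adj G x y)))
  ... | yes (x , y , pair) = x , y , pair
  ... | no none = ⊥-elim (incomplete λ x y x≢y →
          decidable-stable (T? (adj G x y)) (λ ¬x~y → none (x , y , x≢y , ¬x~y)))

  has-neighbour : Connected G → ∀ {x y} → x ≢ y → ∃[ z ] Adj G x z
  has-neighbour connected {x} {y} x≢y with connected x y
  ... | ε         = ⊥-elim (x≢y refl)
  ... | x~z ◅ _   = _ , x~z

  Dominated : Subset n → Fin n → Set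
  Dominated S x = ∃[ t ] (t ∈ S × Adj G t x)

  dominated? : ∀ S x → Dec (Dominated S x)
  dominated? S x = any? λ t → (t ∈? S) ×-dec T? (adj G t x)

  ForcingMove : Subset n → Set
  ForcingMove S = ∃[ u ] (u ∉ S × (∀ w → Adj G u w → w ∉ S) ×
                          ∃[ v ] (v ∉ S × Adj G u v × Dominated S v))

  forcingMove? : ∀ S → Dec (ForcingMove S)
  forcingMove? S =
    any? λ u → ¬? (u ∈? S) ×-dec all? (λ w → T? (adj G u w) →-dec ¬? (w ∈? S)) ×-dec
    any? λ v → ¬? (v ∈? S) ×-dec T? (adj G u v) ×-dec dominated? S v

  ∁-zeroForcing-step : ∀ {S u v} → ZeroForcingSet G (∁ S) → u ∉ S →
    (∀ w → Adj G u w → w ∉ S) → Adj G u v → ZeroForcingSet G (∁ (S ∪ ⁅ v ⁆))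
  ∁-zeroForcing-step {S} {u} {v} zeroForcing u∉S u-isolated u~v x =
    Forced-mono ∁S⊆forced (zeroForcing x)
    where
    outside : ∀ {y} → y ∉ S → y ≢ v → Forced G (∁ (S ∪ ⁅ v ⁆)) y
    outside y∉S y≢v = initial (x∉p⇒x∈∁p (x∉p∧x≢y⇒x∉p∪⁅y⁆ y∉S y≢v))
    ∁S⊆forced : ∀ {y} → y ∈ ∁ S → Forced G (∁ (S ∪ ⁅ v ⁆)) y
    ∁S⊆forced {y} y∈∁S with y ≟ᶠ v
    ... | yes refl = force (outside u∉S (Adj⇒≢ u~v)) u~v (λ w u~w → outside (u-isolated w u~w))
    ... | no y≢v   = outside (x∈∁p⇒x∉p y∈∁S) y≢v

  stuck⇒dominated : Connected G → ∀ {S x₀} → x₀ ∈ S → ¬ ForcingMove S →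
    ∀ {x} → x ∉ S → Dominated S x
  stuck⇒dominated connected {S} {x₀} x₀∈S stuck {x} x∉S =
    decidable-stable (dominated? S x) (λ ¬dom → walk (connected x x₀) x∉S ¬dom x₀∈S)
    where
    -- Otherwise y would be the forcer of a move towards z.
    spread : ∀ {y z} → Adj G y z → y ∉ S → ¬ Dominated S y → z ∉ S × ¬ Dominated S z
    spread {y} {z} y~z y∉S ¬dom-y = z∉S , ¬dom-z
      where
      z∉S : z ∉ S
      z∉S z∈S = ¬dom-y (z , z∈S , Adj-sym y~z)
      ¬dom-z : ¬ Dominated S z
      ¬dom-z dom-z = stuck (y , y∉S , (λ w y~w w∈S → ¬dom-y (w , w∈S , Adj-sym y~w)) ,
                            z , z∉S , y~z , dom-z)
    walk : ∀ {y z} → Star (Adj G) y z → y ∉ S → ¬ Dominated S y → z ∉ S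
    walk ε          y∉S ¬dom = y∉S
    walk (y~ ◅ path) y∉S ¬dom = walk path (proj₁ (spread y~ y∉S ¬dom)) (proj₂ (spread y~ y∉S ¬dom))

  module Greedy (Δ : ℕ) (degree≤Δ : ∀ v → degree G v ≤ Δ) (x₀ : Fin n) where

    ∣neighbours∣≤Δ : ∀ v → ∣ neighbours v ∣ ≤ Δ
    ∣neighbours∣≤Δ v = subst (_≤ Δ) (degree≡∣neighbours∣ v) (degree≤Δ v)

    -- D over-approximates the vertices outside S with a neighbour in S, and ∣D∣-bound is
    -- ∣ D ∣ ≤ (Δ − 2) ∣ S ∣ + 2 stated without truncated subtraction.
    record Invariant (S : Subset n) : Set where
      field
        zeroForcing : ZeroForcingSet G (∁ S)
        D           : Subset n
        dominated⊆D : ∀ {x} → x ∉ S → Dominated S x → x ∈ D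
        ∣D∣-bound   : ∣ D ∣ + 2 * ∣ S ∣ ≤ Δ * ∣ S ∣ + 2
        x₀∈S        : x₀ ∈ S

    start : ∀ {z} → Adj G z x₀ → Invariant ⁅ x₀ ⁆
    start z~x₀ = record
      { zeroForcing = subst (ZeroForcingSet G ∘ ∁) (∪-identityˡ ⁅ x₀ ⁆)
                        (∁-zeroForcing-step (λ _ → initial (x∉p⇒x∈∁p ∉⊥)) ∉⊥ (λ _ _ → ∉⊥) z~x₀)
      ; D           = neighbours x₀
      ; dominated⊆D = λ { _ (t , t∈⁅x₀⁆ , t~x) →
                          ∈-neighbours⁺ (subst (λ t → Adj G t _) (x∈⁅y⁆⇒x≡y x₀ t∈⁅x₀⁆) t~x) }
      ; ∣D∣-bound   = bound
      ; x₀∈S        = x∈⁅x⁆ x₀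
      }
      where
      bound : ∣ neighbours x₀ ∣ + 2 * ∣ ⁅ x₀ ⁆ ∣ ≤ Δ * ∣ ⁅ x₀ ⁆ ∣ + 2
      bound rewrite ∣⁅x⁆∣≡1 x₀ | *-identityʳ Δ = +-monoˡ-≤ 2 (∣neighbours∣≤Δ x₀)

    extend : ∀ {S} → Invariant S → ForcingMove S → ∃[ S′ ] (Invariant S′ × ∣ S′ ∣ ≡ suc ∣ S ∣)
    extend {S} inv (u , u∉S , u-isolated , v , v∉S , u~v , t , t∈S , t~v) =
      S ∪ ⁅ v ⁆ , invariant′ , ∣S∪⁅v⁆∣≡1+∣S∣
      where
      open Invariant inv
      ∣S∪⁅v⁆∣≡1+∣S∣ : ∣ S ∪ ⁅ v ⁆ ∣ ≡ suc ∣ S ∣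
      ∣S∪⁅v⁆∣≡1+∣S∣ = x∉p⇒∣p∪⁅x⁆∣≡1+∣p∣ S v∉S
      D′ : Subset n
      D′ = (D - v) ∪ (neighbours v ─ S)
      dominated⊆D′ : ∀ {x} → x ∉ S ∪ ⁅ v ⁆ → Dominated (S ∪ ⁅ v ⁆) x → x ∈ D′
      dominated⊆D′ {x} x∉S′ (t′ , t′∈S′ , t′~x) with x∈p∪q⁻ S ⁅ v ⁆ t′∈S′
      ... | inj₁ t′∈S   = x∈p∪q⁺ (inj₁ (x∈p∧x≢y⇒x∈p-y
                            (dominated⊆D (x∉p∪⁅y⁆⇒x∉p x∉S′) (t′ , t′∈S , t′~x)) (x∉p∪⁅y⁆⇒x≢y x∉S′)))
      ... | inj₂ t′∈⁅v⁆ = x∈p∪q⁺ (inj₂ (x∈p∧x∉q⇒x∈p─q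
                            (∈-neighbours⁺ (subst (λ t → Adj G t x) (x∈⁅y⁆⇒x≡y v t′∈⁅v⁆) t′~x))
                            (x∉p∪⁅y⁆⇒x∉p x∉S′)))
      ∣D′∣+2≤∣D∣+Δ : ∣ D′ ∣ + 2 ≤ ∣ D ∣ + Δ
      ∣D′∣+2≤∣D∣+Δ = begin
        ∣ D′ ∣ + 2                                 ≤⟨ +-monoˡ-≤ 2 (∣p∪q∣≤∣p∣+∣q∣ (D - v) (neighbours v ─ S)) ⟩
        ∣ D - v ∣ + ∣ neighbours v ─ S ∣ + 2       ≡⟨ +-suc-suc ∣ D - v ∣ ∣ neighbours v ─ S ∣ ⟩
        suc ∣ D - v ∣ + suc ∣ neighbours v ─ S ∣   ≤⟨ +-mono-≤ v-leaves (≤-trans t-not-new (∣neighbours∣≤Δ v)) ⟩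
        ∣ D ∣ + Δ                                  ∎
        where
        open ≤-Reasoning
        +-suc-suc : ∀ a b → a + b + 2 ≡ suc a + suc b
        +-suc-suc = solve-∀
        v-leaves : suc ∣ D - v ∣ ≤ ∣ D ∣
        v-leaves = x∈p⇒∣p-x∣<∣p∣ (dominated⊆D v∉S (t , t∈S , t~v))
        t-not-new : suc ∣ neighbours v ─ S ∣ ≤ ∣ neighbours v ∣
        t-not-new = p∩q≢∅⇒∣p─q∣<∣p∣ (neighbours v) S (t , x∈p∩q⁺ (∈-neighbours⁺ (Adj-sym t~v) , t∈S))
      invariant′ : Invariant (S ∪ ⁅ v ⁆)
      invariant′ = record
        { zeroForcing = ∁-zeroForcing-step zeroForcing u∉S u-isolated u~v
        ; D           = D′
        ; dominated⊆D = dominated⊆D′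
        ; ∣D∣-bound   = subst (λ s → ∣ D′ ∣ + 2 * s ≤ Δ * s + 2) (sym ∣S∪⁅v⁆∣≡1+∣S∣)
                          (growth-bound Δ ∣D′∣+2≤∣D∣+Δ ∣D∣-bound)
        ; x₀∈S        = x∈p∪q⁺ (inj₁ x₀∈S)
        }

    saturate : ∀ {S} → Invariant S → ∃[ S′ ] (Invariant S′ × ¬ ForcingMove S′)
    saturate {S} = go (n ∸ ∣ S ∣) (m+[n∸m]≡n (∣p∣≤n S))
      where
      go : ∀ fuel {S} → ∣ S ∣ + fuel ≡ n → Invariant S → ∃[ S′ ] (Invariant S′ × ¬ ForcingMove S′)
      go fuel {S} size inv with forcingMove? S
      ... | no stuck = S , inv , stuck
      go zero {S} size inv | yes (_ , _ , _ , v , v∉S , _) =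
        ⊥-elim (v∉S (subst (v ∈_) (sym (∣p∣≡n⇒p≡⊤ (trans (sym (+-identityʳ ∣ S ∣)) size))) ∈⊤))
      go (suc fuel) size inv | yes move with extend inv move
      ... | S′ , inv′ , ∣S′∣≡1+∣S∣ =
        go fuel (trans (cong (_+ fuel) ∣S′∣≡1+∣S∣) (trans (sym (+-suc _ fuel)) size)) inv′

    large-zeroForcing-complement : Connected G → ∀ {y} → x₀ ≢ y → ¬ Adj G x₀ y →
      ∃[ S ] (ZeroForcingSet G (∁ S) × n ≤ Δ * ∣ S ∣)
    large-zeroForcing-complement connected {y} x₀≢y ¬x₀~y
      with saturate (start (Adj-sym (proj₂ (has-neighbour connected x₀≢y))))
    ... | S , inv , stuck = S , zeroForcing , n∸s≤d⇒n≤Δ*s Δ n∸∣S∣≤∣D∣ ∣D∣-bound 2≤∣S∣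
      where
      open Invariant inv
      dominated : ∀ {x} → x ∉ S → Dominated S x
      dominated = stuck⇒dominated connected x₀∈S stuck
      n∸∣S∣≤∣D∣ : n ∸ ∣ S ∣ ≤ ∣ D ∣
      n∸∣S∣≤∣D∣ = subst (_≤ ∣ D ∣) (∣∁p∣≡n∸∣p∣ S) (p⊆q⇒∣p∣≤∣q∣ λ x∈∁S →
        dominated⊆D (x∈∁p⇒x∉p x∈∁S) (dominated (x∈∁p⇒x∉p x∈∁S)))
      2≤∣S∣ : 2 ≤ ∣ S ∣
      2≤∣S∣ with y ∈? S
      ... | yes y∈S = x∈p∧y∈p∧x≢y⇒2≤∣p∣ x₀∈S y∈S x₀≢y
      ... | no y∉S with dominated y∉S
      ...   | t , t∈S , t~y = x∈p∧y∈p∧x≢y⇒2≤∣p∣ x₀∈S t∈S (λ { refl → ¬x₀~y t~y })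

proposition1 : ∀ {n} (G : Graph n) (Δ : ℕ) → Connected G → MaxDegree G Δ →
    3 ≤ Δ → ¬ IsComplete G (Δ + 1) →
    ∀ (k : ℕ) → IsZeroForcingNumber G k → Δ * k ≤ (Δ ∸ 1) * n
proposition1 {n} G Δ connected (degree≤Δ , v , degree-v≡Δ) _ ¬K k (_ , minimal) =
  from-nonadjacent-pair (nonadjacent-pair G incomplete)
  where
  incomplete : ¬ Complete G
  incomplete complete =
    ¬K (trans (Complete⇒n≡degree+1 G complete v) (cong (_+ 1) degree-v≡Δ) , complete)
  from-complement : ∃[ S ] (ZeroForcingSet G (∁ S) × n ≤ Δ * ∣ S ∣) → Δ * k ≤ (Δ ∸ 1) * n
  from-complement (S , zeroForcing , n≤Δ∣S∣) =
    k≤n∸s⇒Δ*k≤[Δ∸1]*n Δ (subst (k ≤_) (∣∁p∣≡n∸∣p∣ S) (minimal (∁ S) zeroForcing)) n≤Δ∣S∣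
  from-nonadjacent-pair : (∃₂ λ x y → x ≢ y × ¬ Adj G x y) → Δ * k ≤ (Δ ∸ 1) * n
  from-nonadjacent-pair (x₀ , y , x₀≢y , ¬x₀~y) = from-complement
    (Greedy.large-zeroForcing-complement G Δ degree≤Δ x₀ connected x₀≢y ¬x₀~y)
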